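{- Let $\alpha>0$ and let $G$ be a graph with $n$ vertices and at least $\big(\frac59+\alpha\big)\frac{n^2}{2}$ edges. If $A=\{x\in V(G): d(x)<n/3\}$ and $B=\{x\in V(G): |N(x)\setminus A|\le\alpha n/3\}$, then $e(A\cup B)\le\frac{n^2}{18}$.
   Context: $d(x)$ and $N(x)$ denote degree and neighbourhood of $x$ in $G$; $e(X)$ denotes the number of edges of $G$ with both endpoints in $X$.
   Formalization: The parameter α ranges over the positive rationals. -}

module Defs where

open import Data.Bool using (Bool; true; false; _∧_; _∨_; not)
open import Data.Nat using (ℕ; _*_; _<ᵇ_)
open import Data.Fin using (Fin; toℕ)
open import Data.List using (List; filter; length; allFin; map)
open import Data.Nat.ListAction using (sum)
open import Data.Integer using (+_)
open import Data.Rational using (ℚ; _/_) renaming (_*_ to _*ℚ_; _≤ᵇ_ to _≤ᵇℚ_)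
open import Relation.Binary.PropositionalEquality using (_≡_)

record Graph (n : ℕ) : Set where
  field
    adj    : Fin n → Fin n → Bool
    sym    : ∀ x y → adj x y ≡ adj y x
    irrefl : ∀ x → adj x x ≡ false
open Graph public

count : {n : ℕ} → (Fin n → Bool) → ℕ
count {n} P = length (filter (λ x → Data.Bool.T? (P x)) (allFin n))
  where import Data.Bool

deg : {n : ℕ} → Graph n → Fin n → ℕ
deg G x = count (adj G x)

-- e(X): number of edges with both endpoints in X (each edge {x,y} counted once,
-- via the pair with toℕ x < toℕ y)
eIn : {n : ℕ} → Graph n → (Fin n → Bool) → ℕ
eIn {n} G X =
  sum (map (λ x → count (λ y → (toℕ x <ᵇ toℕ y) ∧ adj G x y ∧ X x ∧ X y)) (allFin n))

edges : {n : ℕ} → Graph n → ℕ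
edges G = eIn G (λ _ → true)

inA : {n : ℕ} → Graph n → Fin n → Bool
inA {n} G x = (3 * deg G x) <ᵇ n

ℕtoℚ : ℕ → ℚ
ℕtoℚ k = (+ k) / 1

inB : {n : ℕ} → ℚ → Graph n → Fin n → Bool
inB {n} α G x =
  ℕtoℚ (3 * count (λ y → adj G x y ∧ not (inA G y))) ≤ᵇℚ (α *ℚ ℕtoℚ n)

module Submission where

-- Split V(G) into A, B' = B ∖ A and R = V ∖ (A ∪ B), of sizes a, b, r, and write
-- E(F, H) for the number of ordered adjacent pairs in F × H.  With
--   X = E(A,A), Y = E(A,B'), Z = E(A,R), Q = E(R,R), w = E(B', V ∖ A)
-- double counting gives
--   Σ_{x∈A} d(x) = X + Y + Z,      2e(G) ≤ (X + 2Y + 2Z + Q) + 2w,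
--   2e(A ∪ B) ≤ X + 2Y + w,       2e(A ∪ B) ≤ (a + b)²,
-- while the definitions of A and B give 3(X + Y + Z) ≤ an and 3w ≤ αbn ≤ αn².
-- Together with the density hypothesis this leaves a polynomial problem in a, b, r
-- (`counting-bound`): if 18 e(A ∪ B) > n², three quadratic inequalities in a, b, r
-- hold simultaneously, and a two-case analysis (r ≥ 2a or r ≤ 2a) shows that they
-- cannot (`incompatible`).

open import Data.Bool using (Bool)
open import Data.Nat using (ℕ)
open import Data.Fin using (Fin)
open import Defs using (Graph)

module Sums where

  open import Data.Bool using (true; false; _∧_; T?)
  open import Data.Nat
  open import Data.Nat.Properties
  open import Data.Nat.ListAction using () renaming (sum to sumList)
  open import Data.Fin using (toℕ; zero; suc)
  open import Data.Fin.Properties using (toℕ-injective)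
  open import Data.List using (filter; length; map; tabulate)
  open import Algebra.Properties.Semiring.Sum +-*-semiring public
    using (sum; sum-syntax; ∑-distrib-+; ∑-comm; *-distribˡ-sum; *-distribʳ-sum; sum-cong-≗)
  open import Function using (_∘_)
  open import Relation.Binary.PropositionalEquality
  open import Relation.Nullary.Reflects using (ofʸ; ofⁿ)
  open import Data.Empty using (⊥-elim)
  open import Defs using (count)

  ⟦_⟧ : Bool → ℕ
  ⟦ true ⟧  = 1
  ⟦ false ⟧ = 0

  ⟦⟧≤1 : ∀ b → ⟦ b ⟧ ≤ 1
  ⟦⟧≤1 true  = ≤-refl
  ⟦⟧≤1 false = z≤n

  ⟦∧⟧ : ∀ b c → ⟦ b ∧ c ⟧ ≡ ⟦ b ⟧ * ⟦ c ⟧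
  ⟦∧⟧ true  c = sym (+-identityʳ ⟦ c ⟧)
  ⟦∧⟧ false c = refl

  ∑-mono : ∀ {n} {f g : Fin n → ℕ} → (∀ i → f i ≤ g i) → sum f ≤ sum g
  ∑-mono {zero}  f≤g = z≤n
  ∑-mono {suc n} f≤g = +-mono-≤ (f≤g zero) (∑-mono (f≤g ∘ suc))

  ∑-ones : ∀ n → ∑[ i < n ] 1 ≡ n
  ∑-ones zero    = refl
  ∑-ones (suc n) = cong suc (∑-ones n)

  sumList-tabulate : ∀ {A : Set} n (h : Fin n → A) (f : A → ℕ) →
    sumList (map f (tabulate h)) ≡ ∑[ i < n ] f (h i)
  sumList-tabulate zero    h f = refl
  sumList-tabulate (suc n) h f = cong (f (h zero) +_) (sumList-tabulate n (h ∘ suc) f)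

  length-filter-tabulate : ∀ {A : Set} n (h : Fin n → A) (P : A → Bool) →
    length (filter (λ x → T? (P x)) (tabulate h)) ≡ ∑[ i < n ] ⟦ P (h i) ⟧
  length-filter-tabulate zero    h P = refl
  length-filter-tabulate (suc n) h P with P (h zero)
  ... | true  = cong suc (length-filter-tabulate n (h ∘ suc) P)
  ... | false = length-filter-tabulate n (h ∘ suc) P

  count≡∑ : ∀ {n} (P : Fin n → Bool) → count P ≡ ∑[ x < n ] ⟦ P x ⟧
  count≡∑ {n} P = length-filter-tabulate n (λ x → x) P

  _<ᶠ_ : ∀ {n} → Fin n → Fin n → Bool
  x <ᶠ y = toℕ x <ᵇ toℕ y

  -- Off the diagonal exactly one of x <ᶠ y, y <ᶠ x holds.
  split-by-order : ∀ {n} (M : Fin n → Fin n → ℕ) → (∀ x → M x x ≡ 0) →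
    ∀ x y → M x y ≡ ⟦ x <ᶠ y ⟧ * M x y + ⟦ y <ᶠ x ⟧ * M x y
  split-by-order M diag x y
    with toℕ x <ᵇ toℕ y | <ᵇ-reflects-< (toℕ x) (toℕ y) | toℕ y <ᵇ toℕ x | <ᵇ-reflects-< (toℕ y) (toℕ x)
  ... | true  | ofʸ x<y | true  | ofʸ y<x = ⊥-elim (<-asym x<y y<x)
  ... | true  | _       | false | _       = sym (trans (+-identityʳ (1 * M x y)) (*-identityˡ (M x y)))
  ... | false | _       | true  | _       = sym (*-identityˡ (M x y))
  ... | false | ofⁿ x≮y | false | ofⁿ y≮x = subst (λ z → M x z ≡ 0) x≡y (diag x)
    where
    x≡y : x ≡ y
    x≡y = toℕ-injective (≤-antisym (≮⇒≥ y≮x) (≮⇒≥ x≮y))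

  ∑∑-symmetric : ∀ {n} (M : Fin n → Fin n → ℕ) → (∀ x y → M x y ≡ M y x) → (∀ x → M x x ≡ 0) →
    ∑[ x < n ] ∑[ y < n ] M x y ≡ 2 * ∑[ x < n ] ∑[ y < n ] (⟦ x <ᶠ y ⟧ * M x y)
  ∑∑-symmetric {n} M symm diag = begin
      ∑[ x < n ] ∑[ y < n ] M x y
    ≡⟨ sum-cong-≗ (λ x → trans (sum-cong-≗ (split-by-order M diag x)) (∑-distrib-+ (below x) (above x))) ⟩
      ∑[ x < n ] (∑[ y < n ] below x y + ∑[ y < n ] above x y)
    ≡⟨ ∑-distrib-+ (sum ∘ below) (sum ∘ above) ⟩
      H + ∑[ x < n ] ∑[ y < n ] above x y
    ≡⟨ cong (H +_) (∑-comm above) ⟩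
      H + ∑[ y < n ] ∑[ x < n ] (⟦ y <ᶠ x ⟧ * M x y)
    ≡⟨ cong (H +_) (sum-cong-≗ λ y → sum-cong-≗ λ x → cong (⟦ y <ᶠ x ⟧ *_) (symm x y)) ⟩
      H + H
    ≡⟨ cong (H +_) (sym (+-identityʳ H)) ⟩
      2 * H ∎
    where
    open ≡-Reasoning
    below above : Fin n → Fin n → ℕ
    below x y = ⟦ x <ᶠ y ⟧ * M x y
    above x y = ⟦ y <ᶠ x ⟧ * M x y
    H : ℕ
    H = ∑[ x < n ] ∑[ y < n ] below x y

-- For weights f, g on the vertices,
--   nbr g x = Σ_y g(y)·[x ~ y]        (the g-weighted degree of x),
--   E f g   = Σ_x f(x)·nbr g x = Σ_{x,y} f(x) g(y) [x ~ y];
-- for indicators of F and H, E counts the ordered adjacent pairs in F × H.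
module PairCounts {n : ℕ} (G : Graph n) where

  open import Data.Bool using (true; false; _∧_; not; T)
  open import Data.Nat hiding (ℕ)
  open import Data.Nat.Properties
  open import Function using (_∘_)
  open import Relation.Binary.PropositionalEquality
  open import Algebra.Properties.CommutativeSemigroup *-commutativeSemigroup using (x∙yz≈y∙xz; x∙yz≈y∙zx)
  open import Defs using (adj; irrefl; count; deg; eIn) renaming (sym to adj-sym)
  open Sums

  edge : Fin n → Fin n → ℕ
  edge x y = ⟦ adj G x y ⟧

  nbr : (Fin n → ℕ) → Fin n → ℕ
  nbr g x = ∑[ y < n ] (g y * edge x y)

  E : (Fin n → ℕ) → (Fin n → ℕ) → ℕ
  E f g = ∑[ x < n ] (f x * nbr g x)

  E-expand : ∀ f g → E f g ≡ ∑[ x < n ] ∑[ y < n ] (f x * (g y * edge x y))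
  E-expand f g = sum-cong-≗ λ x → *-distribˡ-sum (f x) (λ y → g y * edge x y)

  swap-weights : ∀ (f g : Fin n → ℕ) x y → f x * (g y * edge x y) ≡ g y * (f x * edge y x)
  swap-weights f g x y rewrite adj-sym G x y = x∙yz≈y∙xz (f x) (g y) (edge y x)

  E-sym : ∀ f g → E f g ≡ E g f
  E-sym f g = begin
      E f g
    ≡⟨ E-expand f g ⟩
      ∑[ x < n ] ∑[ y < n ] (f x * (g y * edge x y))
    ≡⟨ ∑-comm (λ x y → f x * (g y * edge x y)) ⟩
      ∑[ y < n ] ∑[ x < n ] (f x * (g y * edge x y))
    ≡⟨ sum-cong-≗ (λ y → sum-cong-≗ λ x → swap-weights f g x y) ⟩
      ∑[ y < n ] ∑[ x < n ] (g y * (f x * edge y x))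
    ≡⟨ E-expand g f ⟨
      E g f ∎
    where open ≡-Reasoning

  E-linearˡ : ∀ {f} f₁ f₂ g → (∀ x → f x ≡ f₁ x + f₂ x) → E f g ≡ E f₁ g + E f₂ g
  E-linearˡ f₁ f₂ g split = trans
    (sum-cong-≗ λ x → trans (cong (_* nbr g x) (split x)) (*-distribʳ-+ (nbr g x) (f₁ x) (f₂ x)))
    (∑-distrib-+ (λ x → f₁ x * nbr g x) (λ x → f₂ x * nbr g x))

  E-linearʳ : ∀ f {g} g₁ g₂ → (∀ y → g y ≡ g₁ y + g₂ y) → E f g ≡ E f g₁ + E f g₂
  E-linearʳ f {g} g₁ g₂ split = begin
    E f g           ≡⟨ E-sym f g ⟩
    E g f           ≡⟨ E-linearˡ g₁ g₂ f split ⟩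
    E g₁ f + E g₂ f ≡⟨ cong₂ _+_ (E-sym g₁ f) (E-sym g₂ f) ⟩
    E f g₁ + E f g₂ ∎
    where open ≡-Reasoning

  E-monoʳ : ∀ f {g₁ g₂} → (∀ y → g₁ y ≤ g₂ y) → E f g₁ ≤ E f g₂
  E-monoʳ f g₁≤g₂ = ∑-mono λ x → *-monoʳ-≤ (f x) (∑-mono λ y → *-monoˡ-≤ (edge x y) (g₁≤g₂ y))

  E-≤-product : ∀ f g → E f g ≤ sum f * sum g
  E-≤-product f g = begin
    ∑[ x < n ] (f x * nbr g x) ≤⟨ ∑-mono (λ x → *-monoʳ-≤ (f x) (nbr≤∑ x)) ⟩
    ∑[ x < n ] (f x * sum g)   ≡⟨ *-distribʳ-sum (sum g) f ⟨
    sum f * sum g              ∎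
    where
    open ≤-Reasoning
    nbr≤∑ : ∀ x → nbr g x ≤ sum g
    nbr≤∑ x = ∑-mono λ y →
      ≤-trans (*-monoʳ-≤ (g y) (⟦⟧≤1 (adj G x y))) (≤-reflexive (*-identityʳ (g y)))

  E-row-bound : ∀ (S : Fin n → Bool) g c k → (∀ x → T (S x) → c * nbr g x ≤ k) →
    c * E (⟦_⟧ ∘ S) g ≤ sum (⟦_⟧ ∘ S) * k
  E-row-bound S g c k row = begin
      c * ∑[ x < n ] (⟦ S x ⟧ * nbr g x)
    ≡⟨ *-distribˡ-sum c (λ x → ⟦ S x ⟧ * nbr g x) ⟩
      ∑[ x < n ] (c * (⟦ S x ⟧ * nbr g x))
    ≤⟨ ∑-mono bound ⟩
      ∑[ x < n ] (⟦ S x ⟧ * k)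
    ≡⟨ *-distribʳ-sum k (⟦_⟧ ∘ S) ⟨
      sum (⟦_⟧ ∘ S) * k ∎
    where
    open ≤-Reasoning
    bound : ∀ x → c * (⟦ S x ⟧ * nbr g x) ≤ ⟦ S x ⟧ * k
    bound x with S x | row x
    ... | true  | row-x =
      subst₂ _≤_ (cong (c *_) (sym (*-identityˡ (nbr g x)))) (sym (*-identityˡ k)) (row-x _)
    ... | false | _     = ≤-reflexive (*-zeroʳ c)

  deg≡nbr : ∀ x → deg G x ≡ nbr (λ _ → 1) x
  deg≡nbr x = trans (count≡∑ (adj G x)) (sum-cong-≗ λ y → sym (*-identityˡ (edge x y)))

  outside≡nbr : ∀ (A : Fin n → Bool) x →
    count (λ y → adj G x y ∧ not (A y)) ≡ nbr (λ y → ⟦ not (A y) ⟧) x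
  outside≡nbr A x = trans (count≡∑ (λ y → adj G x y ∧ not (A y)))
    (sum-cong-≗ λ y → trans (⟦∧⟧ (adj G x y) (not (A y))) (*-comm (edge x y) ⟦ not (A y) ⟧))

  twice-eIn : ∀ (X : Fin n → Bool) → 2 * eIn G X ≡ E (⟦_⟧ ∘ X) (⟦_⟧ ∘ X)
  twice-eIn X = begin
      2 * eIn G X
    ≡⟨ cong (2 *_) eIn≡ ⟩
      2 * ∑[ x < n ] ∑[ y < n ] (⟦ x <ᶠ y ⟧ * M x y)
    ≡⟨ ∑∑-symmetric M (λ x y → swap-weights χ χ x y) diag ⟨
      ∑[ x < n ] ∑[ y < n ] M x y
    ≡⟨ E-expand χ χ ⟨
      E χ χ ∎
    where
    open ≡-Reasoning
    χ : Fin n → ℕ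
    χ = ⟦_⟧ ∘ X
    M : Fin n → Fin n → ℕ
    M x y = χ x * (χ y * edge x y)
    diag : ∀ x → M x x ≡ 0
    diag x rewrite irrefl G x = trans (cong (χ x *_) (*-zeroʳ (χ x))) (*-zeroʳ (χ x))
    entry : ∀ x y → ⟦ (x <ᶠ y) ∧ adj G x y ∧ X x ∧ X y ⟧ ≡ ⟦ x <ᶠ y ⟧ * M x y
    entry x y = begin
        ⟦ (x <ᶠ y) ∧ adj G x y ∧ X x ∧ X y ⟧
      ≡⟨ ⟦∧⟧ (x <ᶠ y) _ ⟩
        ⟦ x <ᶠ y ⟧ * ⟦ adj G x y ∧ X x ∧ X y ⟧
      ≡⟨ cong (⟦ x <ᶠ y ⟧ *_) (trans (⟦∧⟧ (adj G x y) _) (cong (edge x y *_) (⟦∧⟧ (X x) (X y)))) ⟩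
        ⟦ x <ᶠ y ⟧ * (edge x y * (χ x * χ y))
      ≡⟨ cong (⟦ x <ᶠ y ⟧ *_) (x∙yz≈y∙zx (edge x y) (χ x) (χ y)) ⟩
        ⟦ x <ᶠ y ⟧ * M x y ∎
    eIn≡ : eIn G X ≡ ∑[ x < n ] ∑[ y < n ] (⟦ x <ᶠ y ⟧ * M x y)
    eIn≡ = trans (sumList-tabulate n (λ x → x) _) (sum-cong-≗ λ x →
      trans (count≡∑ (λ y → (x <ᶠ y) ∧ adj G x y ∧ X x ∧ X y)) (sum-cong-≗ (entry x)))

module Arithmetic where

  open import Data.Nat hiding (ℕ)
  open import Data.Nat.Properties
  open import Data.Nat.Tactic.RingSolver using (solve)
  open import Data.List using (_∷_; [])
  open import Data.Product using (_,_)
  open import Data.Sum using (inj₁; inj₂)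
  open import Data.Empty using (⊥; ⊥-elim)
  open import Relation.Nullary using (yes; no)
  open import Relation.Binary.PropositionalEquality

  ≤-by-surplus : ∀ {x y} s → x + s ≡ y → x ≤ y
  ≤-by-surplus {x} s refl = m≤m+n x s

  cancel-≤ : ∀ {L R x y} → R ≤ L → L + y ≤ R + x → y ≤ x
  cancel-≤ {L} {R} {x} {y} R≤L le = +-cancelˡ-≤ R y x (≤-trans (+-monoˡ-≤ y R≤L) le)

  cancel-strict : ∀ {L R x y} → R < L → L + y ≤ R + x → y < x
  cancel-strict {L} {R} {x} {y} R<L le = cancel-≤ {L} {suc R} R<L (begin
    L + suc y   ≡⟨ +-suc L y ⟩
    suc (L + y) ≤⟨ s≤s le ⟩
    suc R + x   ∎)
    where open ≤-Reasoning

  am-gm : ∀ u b → 2 * u * b ≤ u * u + b * b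
  am-gm u b with ≤-total u b
  ... | inj₁ u≤b with m≤n⇒∃[o]m+o≡n u≤b
  ...   | k , refl = ≤-by-surplus (k * k) (solve (u ∷ k ∷ []))
  am-gm u b | inj₂ b≤u with m≤n⇒∃[o]m+o≡n b≤u
  ...   | k , refl = ≤-by-surplus (k * k) (solve (b ∷ k ∷ []))

  -- Write α for 2a.  The three inequalities
  --   (I)   αr + 4br + 2b² < r² + 2αb,
  --   (II)  α² + 10b² + 20br ≤ 2αb + 2αr + 8r²,
  --   (III) r < α + 2b
  -- have no common solution; (I) reads (r − α)(r − 2b) > 2b(r + b).

  -- Case α ≤ r, say r = α + p: by (III) p ≤ 2b, and then (I) fails.
  large-r : ∀ α b p → α * (α + p) + 4 * b * (α + p) + 2 * b * b < (α + p) * (α + p) + 2 * α * b →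
            p ≤ 2 * b → ⊥
  large-r α b p ineq₁ p≤2b = <⇒≱ ineq₁ (begin
      (α + p) * (α + p) + 2 * α * b
    ≡⟨ solve (α ∷ b ∷ p ∷ []) ⟩
      (α * α + 2 * α * b + α * p) + (α * p + p * p)
    ≤⟨ +-monoʳ-≤ (α * α + 2 * α * b + α * p) (+-mono-≤ (*-monoʳ-≤ α p≤2b) (*-monoˡ-≤ p p≤2b)) ⟩
      (α * α + 2 * α * b + α * p) + (α * (2 * b) + 2 * b * p)
    ≤⟨ ≤-by-surplus (2 * b * b + 2 * b * p) (solve (α ∷ b ∷ p ∷ [])) ⟩
      α * (α + p) + 4 * b * (α + p) + 2 * b * b ∎)
    where open ≤-Reasoning

  -- Case r ≤ α, say α = r + u: (I) forces r < 2b, so 9r² ≤ 18br, and then (II) becomes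
  -- u² + 10b² ≤ 2ub ≤ u² + b², impossible for b > 0.
  small-r : ∀ r b u → (r + u) * r + 4 * b * r + 2 * b * b < r * r + 2 * (r + u) * b →
            (r + u) * (r + u) + 10 * b * b + 20 * b * r ≤ 2 * (r + u) * b + 2 * (r + u) * r + 8 * r * r → ⊥
  small-r r b u ineq₁ ineq₂ =
    no-small-b {b = b} r<2b (+-cancelˡ-≤ (u * u + 18 * b * r) (b * b * 10) (b * b) (begin
      (u * u + 18 * b * r) + b * b * 10
    ≡⟨ solve (r ∷ b ∷ u ∷ []) ⟩
      u * u + 10 * b * b + 18 * b * r
    ≤⟨ ineq₂-reduced ⟩
      2 * u * b + 9 * r * r
    ≤⟨ +-monoʳ-≤ (2 * u * b) 9r²≤18br ⟩
      2 * u * b + 18 * b * r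
    ≤⟨ +-monoˡ-≤ (18 * b * r) (am-gm u b) ⟩
      (u * u + b * b) + 18 * b * r
    ≡⟨ solve (r ∷ b ∷ u ∷ []) ⟩
      (u * u + 18 * b * r) + b * b ∎))
    where
    open ≤-Reasoning

    -- (I) is  (r² + 2rb) + (ur + 2br + 2b²) < (r² + 2rb) + 2ub.
    ur<2ub : u * r < u * (2 * b)
    ur<2ub = ≤-<-trans (m≤m+n (u * r) (2 * b * r + 2 * b * b))
      (+-cancelˡ-< (r * r + 2 * r * b) _ _ (begin-strict
        (r * r + 2 * r * b) + (u * r + (2 * b * r + 2 * b * b))
      ≡⟨ solve (r ∷ b ∷ u ∷ []) ⟩
        (r + u) * r + 4 * b * r + 2 * b * b
      <⟨ ineq₁ ⟩
        r * r + 2 * (r + u) * b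
      ≡⟨ solve (r ∷ b ∷ u ∷ []) ⟩
        (r * r + 2 * r * b) + u * (2 * b) ∎))

    r<2b : r < 2 * b
    r<2b = *-cancelˡ-< u r (2 * b) ur<2ub

    9r²≤18br : 9 * r * r ≤ 18 * b * r
    9r²≤18br = begin
      9 * r * r       ≤⟨ *-monoʳ-≤ (9 * r) (<⇒≤ r<2b) ⟩
      9 * r * (2 * b) ≡⟨ solve (r ∷ b ∷ []) ⟩
      18 * b * r      ∎

    ineq₂-reduced : u * u + 10 * b * b + 18 * b * r ≤ 2 * u * b + 9 * r * r
    ineq₂-reduced = +-cancelˡ-≤ (r * r + 2 * r * u + 2 * b * r) _ _ (begin
        (r * r + 2 * r * u + 2 * b * r) + (u * u + 10 * b * b + 18 * b * r)
      ≡⟨ solve (r ∷ b ∷ u ∷ []) ⟩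
        (r + u) * (r + u) + 10 * b * b + 20 * b * r
      ≤⟨ ineq₂ ⟩
        2 * (r + u) * b + 2 * (r + u) * r + 8 * r * r
      ≡⟨ solve (r ∷ b ∷ u ∷ []) ⟩
        (r * r + 2 * r * u + 2 * b * r) + (2 * u * b + 9 * r * r) ∎)

    -- 10b² ≤ b² forces b = 0, contradicting r < 2b.
    no-small-b : ∀ {r b} → r < 2 * b → b * b * 10 ≤ b * b → ⊥
    no-small-b {b = zero} ()
    no-small-b {b = b@(suc _)} _ le = <⇒≱ (m<m*n (b * b) 10 (s≤s (s≤s z≤n))) le

  quadratic-incompatibility : ∀ α b r →
    α * r + 4 * b * r + 2 * b * b < r * r + 2 * α * b →
    α * α + 10 * b * b + 20 * b * r ≤ 2 * α * b + 2 * α * r + 8 * r * r →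
    r < α + 2 * b → ⊥
  quadratic-incompatibility α b r ineq₁ ineq₂ ineq₃ with ≤-total α r
  ... | inj₁ α≤r with m≤n⇒∃[o]m+o≡n α≤r
  ...   | p , refl = large-r α b p ineq₁ (<⇒≤ (+-cancelˡ-< α p (2 * b) ineq₃))
  quadratic-incompatibility α b r ineq₁ ineq₂ ineq₃ | inj₂ r≤α with m≤n⇒∃[o]m+o≡n r≤α
  ...   | u , refl = small-r r b u ineq₁ ineq₂

  -- The same three conditions as they arise from the pair counts, for n = a + b + r:
  --   6n² < 6an + 18ab + 9r²,   5n² ≤ 3an + 9ab + 9ar + 9r²,   n < 3(a + b).
  incompatible-sizes : ∀ n a b r → n ≡ a + b + r →
    6 * (n * n) < 6 * (a * n) + 18 * (a * b) + 9 * (r * r) →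
    5 * (n * n) ≤ 3 * (a * n) + 9 * (a * b) + 9 * (a * r) + 9 * (r * r) →
    n < 3 * (a + b) → ⊥
  incompatible-sizes n a b r n≡ ineq₁ ineq₂ ineq₃ =
    quadratic-incompatibility (2 * a) b r ineq₁′ ineq₂′ ineq₃′
    where
    open ≤-Reasoning
    identity₁ : (6 * (a * n) + 18 * (a * b) + 9 * (r * r)) + 3 * (2 * a * r + 4 * b * r + 2 * b * b)
              ≡ 6 * (n * n) + 3 * (r * r + 2 * (2 * a) * b)
    identity₁ rewrite n≡ = solve (a ∷ b ∷ r ∷ [])

    identity₂ : 2 * (3 * (a * n) + 9 * (a * b) + 9 * (a * r) + 9 * (r * r)) + (2 * a * (2 * a) + 10 * b * b + 20 * b * r)
              ≡ 2 * (5 * (n * n)) + (2 * (2 * a) * b + 2 * (2 * a) * r + 8 * r * r)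
    identity₂ rewrite n≡ = solve (a ∷ b ∷ r ∷ [])

    ineq₁′ : 2 * a * r + 4 * b * r + 2 * b * b < r * r + 2 * (2 * a) * b
    ineq₁′ = *-cancelˡ-< 3 _ _ (cancel-strict ineq₁ (≤-reflexive identity₁))

    ineq₂′ : 2 * a * (2 * a) + 10 * b * b + 20 * b * r ≤ 2 * (2 * a) * b + 2 * (2 * a) * r + 8 * r * r
    ineq₂′ = cancel-≤ (*-monoʳ-≤ 2 ineq₂) (≤-reflexive identity₂)

    ineq₃′ : r < 2 * a + 2 * b
    ineq₃′ = +-cancelˡ-< (a + b) r (2 * a + 2 * b) (begin-strict
        a + b + r               ≡⟨ n≡ ⟨
        n                       <⟨ ineq₃ ⟩
        3 * (a + b)             ≡⟨ solve (a ∷ b ∷ []) ⟩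
        a + b + (2 * a + 2 * b) ∎)

  -- The bound 9T ≤ n² for T = 2e(A ∪ B), from the pair-count inequalities of the overview
  -- (with S = X + 2Y + 2Z + Q, and the density hypothesis already combined into
  -- 5n² + 9w ≤ 9S).  If 9T > n², the three conditions of `incompatible-sizes` hold.
  counting-bound : ∀ n a b r X Y Z Q w T → n ≡ a + b + r →
    3 * (X + Y + Z) ≤ a * n → Y ≤ a * b → Z ≤ a * r → Q ≤ r * r →
    5 * (n * n) + 9 * w ≤ 9 * (X + Y + Z + Y + Z + Q) →
    T ≤ X + Y + Y + w → T ≤ (a + b) * (a + b) →
    9 * T ≤ n * n
  counting-bound n a b r X Y Z Q w T n≡ degA Y≤ab Z≤ar Q≤rr dense T≤ T≤square with 9 * T ≤? n * n
  ... | yes 9T≤n² = 9T≤n²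
  ... | no 9T≰n² = ⊥-elim (incompatible-sizes n a b r n≡ ineq₁ ineq₂ ineq₃)
    where
    open ≤-Reasoning
    n²<9T : n * n < 9 * T
    n²<9T = ≰⇒> 9T≰n²

    -- 9(S + X + 2Y + w) > 5n² + 9w + n², and S + X + 2Y = 2(X + Y + Z) + 2Y + Q.
    ineq₁ : 6 * (n * n) < 6 * (a * n) + 18 * (a * b) + 9 * (r * r)
    ineq₁ = +-cancelˡ-< (9 * w) _ _ (begin-strict
        9 * w + 6 * (n * n)
      ≡⟨ solve (n ∷ w ∷ []) ⟩
        (5 * (n * n) + 9 * w) + n * n
      <⟨ +-mono-≤-< dense n²<9T ⟩
        9 * (X + Y + Z + Y + Z + Q) + 9 * T
      ≤⟨ +-monoʳ-≤ (9 * (X + Y + Z + Y + Z + Q)) (*-monoʳ-≤ 9 T≤) ⟩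
        9 * (X + Y + Z + Y + Z + Q) + 9 * (X + Y + Y + w)
      ≡⟨ solve (X ∷ Y ∷ Z ∷ Q ∷ w ∷ []) ⟩
        9 * w + (6 * (3 * (X + Y + Z)) + 18 * Y + 9 * Q)
      ≤⟨ +-monoʳ-≤ (9 * w)
           (+-mono-≤ (+-mono-≤ (*-monoʳ-≤ 6 degA) (*-monoʳ-≤ 18 Y≤ab)) (*-monoʳ-≤ 9 Q≤rr)) ⟩
        9 * w + (6 * (a * n) + 18 * (a * b) + 9 * (r * r)) ∎)

    ineq₂ : 5 * (n * n) ≤ 3 * (a * n) + 9 * (a * b) + 9 * (a * r) + 9 * (r * r)
    ineq₂ = begin
        5 * (n * n)
      ≤⟨ m≤m+n (5 * (n * n)) (9 * w) ⟩
        5 * (n * n) + 9 * w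
      ≤⟨ dense ⟩
        9 * (X + Y + Z + Y + Z + Q)
      ≡⟨ solve (X ∷ Y ∷ Z ∷ Q ∷ []) ⟩
        3 * (3 * (X + Y + Z)) + 9 * Y + 9 * Z + 9 * Q
      ≤⟨ +-mono-≤ (+-mono-≤ (+-mono-≤ (*-monoʳ-≤ 3 degA) (*-monoʳ-≤ 9 Y≤ab)) (*-monoʳ-≤ 9 Z≤ar))
           (*-monoʳ-≤ 9 Q≤rr) ⟩
        3 * (a * n) + 9 * (a * b) + 9 * (a * r) + 9 * (r * r) ∎

    -- Otherwise 9T ≤ 9(a + b)² ≤ n².
    ineq₃ : n < 3 * (a + b)
    ineq₃ = ≰⇒> λ 3[a+b]≤n → <⇒≱ n²<9T (begin
      9 * T                         ≤⟨ *-monoʳ-≤ 9 T≤square ⟩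
      9 * ((a + b) * (a + b))       ≡⟨ solve (a ∷ b ∷ []) ⟩
      3 * (a + b) * (3 * (a + b))   ≤⟨ *-mono-≤ 3[a+b]≤n 3[a+b]≤n ⟩
      n * n                         ∎)

  -- The density hypothesis, with α = p/d, becomes linear once w is controlled:
  -- d(5N + 27w) ≤ (5d + 9p)N ≤ 18de ≤ 9d(S + 2w).
  density-step : ∀ d p N w S e .{{_ : NonZero d}} →
    (5 * d + 9 * p) * N ≤ 18 * d * e → 3 * d * w ≤ p * N → 2 * e ≤ S + 2 * w →
    5 * N + 9 * w ≤ 9 * S
  density-step d p N w S e dense w≤ e≤ = *-cancelˡ-≤ d (+-cancelʳ-≤ (18 * d * w) _ _ (begin
      d * (5 * N + 9 * w) + 18 * d * w
    ≡⟨ solve (d ∷ N ∷ w ∷ []) ⟩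
      5 * d * N + 9 * (3 * d * w)
    ≤⟨ +-monoʳ-≤ (5 * d * N) (*-monoʳ-≤ 9 w≤) ⟩
      5 * d * N + 9 * (p * N)
    ≡⟨ solve (d ∷ p ∷ N ∷ []) ⟩
      (5 * d + 9 * p) * N
    ≤⟨ dense ⟩
      18 * d * e
    ≡⟨ solve (d ∷ e ∷ []) ⟩
      9 * d * (2 * e)
    ≤⟨ *-monoʳ-≤ (9 * d) e≤ ⟩
      9 * d * (S + 2 * w)
    ≡⟨ solve (d ∷ S ∷ w ∷ []) ⟩
      d * (9 * S) + 18 * d * w ∎))
    where open ≤-Reasoning

module FewEdgesInside {n : ℕ} (G : Graph n) (A B : Fin n → Bool) where

  open import Data.Bool using (true; false; _∧_; _∨_; not; T)
  open import Data.Nat hiding (ℕ)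
  open import Data.Nat.Properties
  open import Relation.Binary.PropositionalEquality
  open import Algebra.Properties.CommutativeSemigroup *-commutativeSemigroup using (x∙yz≈y∙xz; x∙yz≈xz∙y)
  open import Defs using (adj; count; deg; eIn; edges)
  open Sums
  open PairCounts G
  open import Data.Nat.Tactic.RingSolver using (solve-∀)
  open Arithmetic using (counting-bound; density-step)

  χA χN χB χR χS : Fin n → ℕ
  χA x = ⟦ A x ⟧
  χN x = ⟦ not (A x) ⟧
  χB x = ⟦ not (A x) ∧ B x ⟧
  χR x = ⟦ not (A x) ∧ not (B x) ⟧
  χS x = ⟦ A x ∨ B x ⟧

  a b r : ℕ
  a = sum χA
  b = sum χB
  r = sum χR

  X Y Z Q w : ℕ
  X = E χA χA
  Y = E χA χB
  Z = E χA χR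
  Q = E χR χR
  w = E χB χN

  all≡A+N : ∀ x → 1 ≡ χA x + χN x
  all≡A+N x with A x
  ... | true  = refl
  ... | false = refl

  N≡B+R : ∀ x → χN x ≡ χB x + χR x
  N≡B+R x with A x | B x
  ... | true  | _     = refl
  ... | false | true  = refl
  ... | false | false = refl

  S≡A+B : ∀ x → χS x ≡ χA x + χB x
  S≡A+B x with A x | B x
  ... | true  | _     = refl
  ... | false | true  = refl
  ... | false | false = refl

  B≤N : ∀ x → χB x ≤ χN x
  B≤N x = ≤-trans (m≤m+n (χB x) (χR x)) (≤-reflexive (sym (N≡B+R x)))

  R≤N : ∀ x → χR x ≤ χN x
  R≤N x = ≤-trans (m≤n+m (χR x) (χB x)) (≤-reflexive (sym (N≡B+R x)))

  size : n ≡ a + b + r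
  size = begin
    n                       ≡⟨ sym (∑-ones n) ⟩
    ∑[ x < n ] 1            ≡⟨ trans (sum-cong-≗ all≡A+N) (∑-distrib-+ χA χN) ⟩
    a + sum χN              ≡⟨ cong (a +_) (trans (sum-cong-≗ N≡B+R) (∑-distrib-+ χB χR)) ⟩
    a + (b + r)             ≡⟨ sym (+-assoc a b r) ⟩
    a + b + r               ∎
    where open ≡-Reasoning

  degrees-in-A : E χA (λ _ → 1) ≡ X + Y + Z
  degrees-in-A = begin
    E χA (λ _ → 1)  ≡⟨ E-linearʳ χA χA χN all≡A+N ⟩
    X + E χA χN     ≡⟨ cong (X +_) (E-linearʳ χA χB χR N≡B+R) ⟩
    X + (Y + Z)     ≡⟨ sym (+-assoc X Y Z) ⟩
    X + Y + Z       ∎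
    where open ≡-Reasoning

  -- 2e(G) ≤ (X + 2Y + 2Z + Q) + 2w: pairs leaving B' or R are charged to Y, Z, Q or w.
  all-pairs : E (λ _ → 1) (λ _ → 1) ≤ (X + Y + Z + Y + Z + Q) + 2 * w
  all-pairs = begin
      E (λ _ → 1) (λ _ → 1)
    ≡⟨ E-linearˡ χA χN (λ _ → 1) all≡A+N ⟩
      E χA (λ _ → 1) + E χN (λ _ → 1)
    ≡⟨ cong₂ _+_ degrees-in-A (E-linearˡ χB χR (λ _ → 1) N≡B+R) ⟩
      (X + Y + Z) + (E χB (λ _ → 1) + E χR (λ _ → 1))
    ≡⟨ cong (λ t → (X + Y + Z) + t)
         (cong₂ _+_ (E-linearʳ χB χA χN all≡A+N) (E-linearʳ χR χA χN all≡A+N)) ⟩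
      (X + Y + Z) + ((E χB χA + w) + (E χR χA + E χR χN))
    ≡⟨ cong (λ t → (X + Y + Z) + t) (cong₂ _+_ (cong (_+ w) (E-sym χB χA))
         (cong₂ _+_ (E-sym χR χA) (E-linearʳ χR χB χR N≡B+R))) ⟩
      (X + Y + Z) + ((Y + w) + (Z + (E χR χB + Q)))
    ≤⟨ +-monoʳ-≤ (X + Y + Z) (+-monoʳ-≤ (Y + w) (+-monoʳ-≤ Z (+-monoˡ-≤ Q R→B≤w))) ⟩
      (X + Y + Z) + ((Y + w) + (Z + (w + Q)))
    ≡⟨ regroup X Y Z Q w ⟩
      (X + Y + Z + Y + Z + Q) + 2 * w ∎
    where
    open ≤-Reasoning
    regroup : ∀ X Y Z Q w → (X + Y + Z) + ((Y + w) + (Z + (w + Q))) ≡ (X + Y + Z + Y + Z + Q) + 2 * w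
    regroup = solve-∀
    R→B≤w : E χR χB ≤ w
    R→B≤w = ≤-trans (≤-reflexive (E-sym χR χB)) (E-monoʳ χB R≤N)

  pairs-in-S : E χS χS ≤ X + Y + Y + w
  pairs-in-S = begin
    E χS χS                     ≡⟨ E-linearˡ χA χB χS S≡A+B ⟩
    E χA χS + E χB χS           ≡⟨ cong₂ _+_ (E-linearʳ χA χA χB S≡A+B) (E-linearʳ χB χA χB S≡A+B) ⟩
    (X + Y) + (E χB χA + E χB χB) ≤⟨ +-monoʳ-≤ (X + Y)
                                      (+-mono-≤ (≤-reflexive (E-sym χB χA)) (E-monoʳ χB B≤N)) ⟩
    (X + Y) + (Y + w)           ≡⟨ sym (+-assoc (X + Y) Y w) ⟩
    X + Y + Y + w               ∎
    where open ≤-Reasoning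

  pairs-in-S≤square : E χS χS ≤ (a + b) * (a + b)
  pairs-in-S≤square = subst (λ s → E χS χS ≤ s * s) (trans (sum-cong-≗ S≡A+B) (∑-distrib-+ χA χB))
    (E-≤-product χS χS)

  few-edges-inside : ∀ d p .{{_ : NonZero d}} →
    (∀ x → T (A x) → 3 * deg G x < n) →
    (∀ x → T (B x) → 3 * count (λ y → adj G x y ∧ not (A y)) * d ≤ p * n) →
    (5 * d + 9 * p) * (n * n) ≤ 18 * d * edges G →
    18 * eIn G (λ x → A x ∨ B x) ≤ n * n
  few-edges-inside d p small-degree few-outside dense = begin
      18 * eIn G (λ x → A x ∨ B x)
    ≡⟨ *-assoc 9 2 (eIn G (λ x → A x ∨ B x)) ⟩
      9 * (2 * eIn G (λ x → A x ∨ B x))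
    ≡⟨ cong (9 *_) (twice-eIn (λ x → A x ∨ B x)) ⟩
      9 * E χS χS
    ≤⟨ counting-bound n a b r X Y Z Q w (E χS χS) size degree-bound
         (E-≤-product χA χB) (E-≤-product χA χR) (E-≤-product χR χR)
         density-bound pairs-in-S pairs-in-S≤square ⟩
      n * n ∎
    where
    open ≤-Reasoning

    degree-bound : 3 * (X + Y + Z) ≤ a * n
    degree-bound = subst (λ t → 3 * t ≤ a * n) degrees-in-A
      (E-row-bound A (λ _ → 1) 3 n λ x x∈A →
        <⇒≤ (subst (λ k → 3 * k < n) (deg≡nbr x) (small-degree x x∈A)))

    B-of-B' : ∀ x → T (not (A x) ∧ B x) → T (B x)
    B-of-B' x with A x
    ... | true  = λ ()
    ... | false = λ x∈B → x∈B

    b≤n : b ≤ n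
    b≤n = ≤-trans (≤-trans (m≤n+m b a) (m≤m+n (a + b) r)) (≤-reflexive (sym size))

    outside-bound : 3 * d * w ≤ p * (n * n)
    outside-bound = begin
      3 * d * w     ≤⟨ E-row-bound (λ x → not (A x) ∧ B x) χN (3 * d) (p * n) row ⟩
      b * (p * n)   ≤⟨ *-monoˡ-≤ (p * n) b≤n ⟩
      n * (p * n)   ≡⟨ x∙yz≈y∙xz n p n ⟩
      p * (n * n)   ∎
      where
      row : ∀ x → T (not (A x) ∧ B x) → 3 * d * nbr χN x ≤ p * n
      row x x∈B' = begin
        3 * d * nbr χN x                                ≡⟨ trans (*-assoc 3 d _) (x∙yz≈xz∙y 3 d _) ⟩
        3 * nbr χN x * d                                ≡⟨ cong (λ k → 3 * k * d) (outside≡nbr A x) ⟨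
        3 * count (λ y → adj G x y ∧ not (A y)) * d     ≤⟨ few-outside x (B-of-B' x x∈B') ⟩
        p * n                                           ∎

    density-bound : 5 * (n * n) + 9 * w ≤ 9 * (X + Y + Z + Y + Z + Q)
    density-bound = density-step d p (n * n) w (X + Y + Z + Y + Z + Q) (edges G) dense outside-bound
      (≤-trans (≤-reflexive (twice-eIn (λ _ → true))) all-pairs)

-- Translating the rational hypotheses, for α = p/(q+1), into inequalities over ℕ.
-- Work in the unnormalised rationals, where ≤ is literally cross-multiplication.
module RationalBounds where

  open import Data.Nat hiding (ℕ)
  open import Data.Nat.Properties using (*-identityʳ; module ≤-Reasoning)
  open import Data.Nat.Tactic.RingSolver using (solve)
  open import Data.List using (_∷_; [])
  open import Data.Integer as ℤ using (+_)
  import Data.Integer.Properties as ℤP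
  open import Data.Nat.Coprimality using (Coprime)
  open import Data.Rational as ℚ using (mkℚ; toℚᵘ)
  import Data.Rational.Properties as ℚP
  open import Data.Rational.Unnormalised as ℚᵘ using (ℚᵘ; mkℚᵘ; ↥_; ↧_; *≤*)
  import Data.Rational.Unnormalised.Properties as ℚᵘP
  open import Relation.Binary.PropositionalEquality
  open import Defs using (ℕtoℚ)

  ℕtoℚᵘ : ℕ → ℚᵘ
  ℕtoℚᵘ k = mkℚᵘ (+ k) 0

  toℚᵘ-ℕtoℚ : ∀ k → toℚᵘ (ℕtoℚ k) ℚᵘ.≃ ℕtoℚᵘ k
  toℚᵘ-ℕtoℚ k = ℚP.toℚᵘ-fromℚᵘ (ℕtoℚᵘ k)

  cross-≤ : ∀ {x y : ℚᵘ} {m₁ d₁ m₂ d₂ : ℕ} → ↥ x ≡ + m₁ → ↧ x ≡ + d₁ → ↥ y ≡ + m₂ → ↧ y ≡ + d₂ →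
    x ℚᵘ.≤ y → m₁ * d₂ ≤ m₂ * d₁
  cross-≤ {m₁ = m₁} {d₁} {m₂} {d₂} ↥x ↧x ↥y ↧y (*≤* le) = ℤP.drop‿+≤+ (subst₂ ℤ._≤_
    (trans (cong₂ ℤ._*_ ↥x ↧y) (sym (ℤP.pos-* m₁ d₂)))
    (trans (cong₂ ℤ._*_ ↥y ↧x) (sym (ℤP.pos-* m₂ d₁))) le)

  module _ (p q : ℕ) .(c : Coprime p (suc q)) where

    α : ℚ.ℚ
    α = mkℚ (+ p) q c

    ≤-α-multipleᵘ : ∀ k m → ℕtoℚ k ℚ.≤ α ℚ.* ℕtoℚ m → ℕtoℚᵘ k ℚᵘ.≤ mkℚᵘ (+ p) q ℚᵘ.* ℕtoℚᵘ m
    ≤-α-multipleᵘ k m h = begin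
        ℕtoℚᵘ k                          ≃⟨ toℚᵘ-ℕtoℚ k ⟨
        toℚᵘ (ℕtoℚ k)                    ≤⟨ ℚP.toℚᵘ-mono-≤ h ⟩
        toℚᵘ (α ℚ.* ℕtoℚ m)              ≃⟨ ℚP.toℚᵘ-homo-* α (ℕtoℚ m) ⟩
        toℚᵘ α ℚᵘ.* toℚᵘ (ℕtoℚ m)        ≃⟨ ℚᵘP.*-congˡ {toℚᵘ α} (toℚᵘ-ℕtoℚ m) ⟩
        mkℚᵘ (+ p) q ℚᵘ.* ℕtoℚᵘ m        ∎
      where open ℚᵘP.≤-Reasoning

    ≤-α-multiple : ∀ k m → ℕtoℚ k ℚ.≤ α ℚ.* ℕtoℚ m → k * suc q ≤ p * m
    ≤-α-multiple k m h = begin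
        k * suc q          ≡⟨ cong (k *_) (*-identityʳ (suc q)) ⟨
        k * (suc q * 1)    ≤⟨ cross-≤ refl refl (sym (ℤP.pos-* p m)) refl (≤-α-multipleᵘ k m h) ⟩
        p * m * 1          ≡⟨ *-identityʳ (p * m) ⟩
        p * m              ∎
      where open ≤-Reasoning

    densityᵘ : ∀ N e → ((+ 5 ℚ./ 9) ℚ.+ α) ℚ.* ℕtoℚ N ℚ.* (+ 1 ℚ./ 2) ℚ.≤ ℕtoℚ e →
      (mkℚᵘ (+ 5) 8 ℚᵘ.+ mkℚᵘ (+ p) q) ℚᵘ.* ℕtoℚᵘ N ℚᵘ.* mkℚᵘ (+ 1) 1 ℚᵘ.≤ ℕtoℚᵘ e
    densityᵘ N e h = begin
        (mkℚᵘ (+ 5) 8 ℚᵘ.+ mkℚᵘ (+ p) q) ℚᵘ.* ℕtoℚᵘ N ℚᵘ.* mkℚᵘ (+ 1) 1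
      ≃⟨ ℚᵘP.*-congʳ (ℚᵘP.*-cong (ℚP.toℚᵘ-homo-+ (+ 5 ℚ./ 9) α) (toℚᵘ-ℕtoℚ N)) ⟨
        toℚᵘ ((+ 5 ℚ./ 9) ℚ.+ α) ℚᵘ.* toℚᵘ (ℕtoℚ N) ℚᵘ.* toℚᵘ (+ 1 ℚ./ 2)
      ≃⟨ ℚᵘP.*-congʳ (ℚP.toℚᵘ-homo-* ((+ 5 ℚ./ 9) ℚ.+ α) (ℕtoℚ N)) ⟨
        toℚᵘ (((+ 5 ℚ./ 9) ℚ.+ α) ℚ.* ℕtoℚ N) ℚᵘ.* toℚᵘ (+ 1 ℚ./ 2)
      ≃⟨ ℚP.toℚᵘ-homo-* (((+ 5 ℚ./ 9) ℚ.+ α) ℚ.* ℕtoℚ N) (+ 1 ℚ./ 2) ⟨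
        toℚᵘ (((+ 5 ℚ./ 9) ℚ.+ α) ℚ.* ℕtoℚ N ℚ.* (+ 1 ℚ./ 2))
      ≤⟨ ℚP.toℚᵘ-mono-≤ h ⟩
        toℚᵘ (ℕtoℚ e)
      ≃⟨ toℚᵘ-ℕtoℚ e ⟩
        ℕtoℚᵘ e ∎
      where open ℚᵘP.≤-Reasoning

    numerator : ∀ N → (+ 5 ℤ.* + suc q ℤ.+ + p ℤ.* + 9) ℤ.* + N ℤ.* + 1 ≡ + ((5 * suc q + p * 9) * N * 1)
    numerator N = sym (begin
        + ((5 * suc q + p * 9) * N * 1)
      ≡⟨ ℤP.pos-* ((5 * suc q + p * 9) * N) 1 ⟩
        + ((5 * suc q + p * 9) * N) ℤ.* + 1
      ≡⟨ cong (ℤ._* + 1) (ℤP.pos-* (5 * suc q + p * 9) N) ⟩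
        + (5 * suc q + p * 9) ℤ.* + N ℤ.* + 1
      ≡⟨ cong (λ z → z ℤ.* + N ℤ.* + 1) (ℤP.pos-+ (5 * suc q) (p * 9)) ⟩
        (+ (5 * suc q) ℤ.+ + (p * 9)) ℤ.* + N ℤ.* + 1
      ≡⟨ cong₂ (λ u v → (u ℤ.+ v) ℤ.* + N ℤ.* + 1) (ℤP.pos-* 5 (suc q)) (ℤP.pos-* p 9) ⟩
        (+ 5 ℤ.* + suc q ℤ.+ + p ℤ.* + 9) ℤ.* + N ℤ.* + 1 ∎)
      where open ≡-Reasoning

    density : ∀ N e → ((+ 5 ℚ./ 9) ℚ.+ α) ℚ.* ℕtoℚ N ℚ.* (+ 1 ℚ./ 2) ℚ.≤ ℕtoℚ e →
      (5 * suc q + 9 * p) * N ≤ 18 * suc q * e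
    density N e h = begin
        (5 * suc q + 9 * p) * N
      ≡⟨ solve (p ∷ q ∷ N ∷ []) ⟩
        (5 * suc q + p * 9) * N * 1 * 1
      ≤⟨ cross-≤ (numerator N) refl refl refl (densityᵘ N e h) ⟩
        e * (9 * suc q * 1 * 2)
      ≡⟨ solve (q ∷ e ∷ []) ⟩
        18 * suc q * e ∎
      where open ≤-Reasoning

open import Defs
open import Data.Bool using (_∨_)
open import Data.Nat using (ℕ; _*_; _≤_)
open import Data.Rational using (ℚ; Positive; _+_; _/_; 1/_) renaming (_*_ to _*ℚ_; _≤_ to _≤ℚ_)
open import Data.Integer using (+_)

open import Data.Bool using (_∧_; not)
open import Data.Nat using (suc)
open import Data.Nat.Properties using (<ᵇ⇒<)
open import Data.Integer using (-[1+_])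
open import Data.Rational using (mkℚ)
open import Data.Rational.Properties using (≤ᵇ⇒≤)
open FewEdgesInside using (few-edges-inside)
open RationalBounds using (≤-α-multiple; density)

-- A positive α is p/(q+1) with p ∈ ℕ; the membership tests defining A and B and the
-- density hypothesis then become the hypotheses of `few-edges-inside`.
lemma2p4 : (α : ℚ) → Positive α → (n : ℕ) → (G : Graph n) →
    ((+ 5 / 9) + α) *ℚ ℕtoℚ (n * n) *ℚ (+ 1 / 2) ≤ℚ ℕtoℚ (edges G) →
    18 * eIn G (λ x → inA G x ∨ inB α G x) ≤ n * n
lemma2p4 (mkℚ -[1+ _ ] _ _) () n G dense
lemma2p4 α@(mkℚ (+ p) q c) _ n G dense =
  few-edges-inside G (inA G) (inB α G) (suc q) p
    (λ x x∈A → <ᵇ⇒< (3 * deg G x) n x∈A)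
    (λ x x∈B → ≤-α-multiple p q c (3 * count (λ y → adj G x y ∧ not (inA G y))) n (≤ᵇ⇒≤ x∈B))
    (density p q c (n * n) (edges G) dense)
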